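{- Let $E$ be a finite set, let $\mathcal{W}\subseteq\{+,-,0\}^E$ be an affine oriented matroid, and let $X,Y\in\mathcal{W}$ with $\underline{X}=\underline{Y}$, $X\neq -Y$ and $I(X,-Y)\cap\mathcal{W}=\emptyset$. Then $B(X,-Y)\cap\mathcal{W}=\emptyset$.
   Context: A sign vector on a finite set $F$ is $X\in\{+,-,0\}^F$ with support $\underline{X}=\{e: X_e\neq0\}$; $-X$ swaps $+$ and $-$; composition $(X\circ Y)_e=X_e$ if $X_e\neq0$, else $Y_e$; $S(X,Y)=\{e: X_e,Y_e\neq0, X_e\neq Y_e\}$. For $X\neq Y$ with $\underline{X}=\underline{Y}$: for $e\in S(X,Y)$, $I_e(X,Y)=\{V : \underline{V}\subseteq\underline{X}-\{e\},\ V_f=X_f \text{ for all } f\notin S(X,Y)\}$; $I(X,Y)=\bigcup_{e\in S(X,Y)}I_e(X,Y)$; $B(X,Y)=\{V : V\notin\{X,Y\},\ \underline{V}=\underline{X},\ V_f=X_f\text{ for all }f\notin S(X,Y)\}$. $\mathcal{O}\subseteq\{+,-,0\}^F$ is an oriented matroid if: (O1) the all-zero vector is in $\mathcal{O}$; (O2) $X\in\mathcal{O}\Rightarrow -X\in\mathcal{O}$; (O3) $X,Y\in\mathcal{O}\Rightarrow X\circ Y\in\mathcal{O}$; (O4) if $X,Y\in\mathcal{O}$ with $\underline{X}=\underline{Y}$ and $e\in S(X,Y)$, there is $Z\in\mathcal{O}$ with $Z_e=0$ and $Z_f=(X\circ Y)_f$ for all $f\notin S(X,Y)$. For $g\notin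 E$, $[X,s]$ is the sign vector on $E\cup\{g\}$ extending $X\in\{+,-,0\}^E$ by value $s$ at $g$. $\mathcal{W}\subseteq\{+,-,0\}^E$ is an affine oriented matroid if there exist $g\notin E$ and an oriented matroid $\mathcal{O}$ on $E\cup\{g\}$ with $\mathcal{W}=\{X: [X,+]\in\mathcal{O}\}$. -}

module Defs where

open import Data.Nat using (ℕ; suc)
open import Data.Fin using (Fin)
open import Data.Vec using (Vec; _∷_; lookup; map; zipWith; replicate)
open import Data.Bool using (Bool; true; false)
open import Data.Product using (_×_; Σ; ∃)
open import Relation.Binary.PropositionalEquality using (_≡_; _≢_)
open import Relation.Nullary using (¬_)
open import Function.Bundles using (_⇔_)

data Sign : Set where
  ⊕ ⊖ ⊙ : Sign

SignVec : ℕ → Set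
SignVec n = Vec Sign n

SVSet : ℕ → Set₁
SVSet n = SignVec n → Set

negS : Sign → Sign
negS ⊕ = ⊖
negS ⊖ = ⊕
negS ⊙ = ⊙

compS : Sign → Sign → Sign
compS ⊙ t = t
compS s t = s

nonzeroS : Sign → Bool
nonzeroS ⊙ = false
nonzeroS _ = true

neg : ∀ {n} → SignVec n → SignVec n
neg = map negS

_∘ₛ_ : ∀ {n} → SignVec n → SignVec n → SignVec n
X ∘ₛ Y = zipWith compS X Y

𝟎 : ∀ {n} → SignVec n
𝟎 = replicate _ ⊙

-- support as a characteristic vector; supports are equal iff these are equal
supp : ∀ {n} → SignVec n → Vec Bool n
supp = map nonzeroS

InS : ∀ {n} → SignVec n → SignVec n → Fin n → Set
InS X Y e = (lookup X e ≢ ⊙) × (lookup Y e ≢ ⊙) × (lookup X e ≢ lookup Y e)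

AgreeOutsideS : ∀ {n} → SignVec n → SignVec n → SignVec n → Set
AgreeOutsideS X Y V = ∀ f → ¬ InS X Y f → lookup V f ≡ lookup X f

InIe : ∀ {n} → SignVec n → SignVec n → Fin n → SignVec n → Set
InIe X Y e V =
  (∀ f → lookup V f ≢ ⊙ → (lookup X f ≢ ⊙) × (f ≢ e)) × AgreeOutsideS X Y V

InI : ∀ {n} → SignVec n → SignVec n → SignVec n → Set
InI X Y V = Σ (Fin _) λ e → InS X Y e × InIe X Y e V

InB : ∀ {n} → SignVec n → SignVec n → SignVec n → Set
InB X Y V = (V ≢ X) × (V ≢ Y) × (supp V ≡ supp X) × AgreeOutsideS X Y V

record IsOM {m : ℕ} (O : SVSet m) : Set where
  field
    O1 : O 𝟎
    O2 : ∀ X → O X → O (neg X)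
    O3 : ∀ X Y → O X → O Y → O (X ∘ₛ Y)
    O4 : ∀ X Y → O X → O Y → supp X ≡ supp Y → ∀ e → InS X Y e →
         Σ (SignVec m) λ Z → O Z × (lookup Z e ≡ ⊙) ×
           (∀ f → ¬ InS X Y f → lookup Z f ≡ lookup (X ∘ₛ Y) f)

-- affine oriented matroid: the new element g is the index 0 of Fin (suc n),
-- and [X,s] = s ∷ X
IsAffineOM : ∀ {n} → SVSet n → Set₁
IsAffineOM {n} W =
  Σ (SVSet (suc n)) λ O → IsOM O × (∀ X → W X ⇔ O (⊕ ∷ X))

module Submission where

open import Defs
open import Data.Nat using (ℕ)
open import Data.Fin using (zero; suc)
open import Data.Fin.Properties using (¬∀⟶∃¬)
open import Data.Vec using (_∷_; lookup; tabulate)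
open import Data.Vec.Properties using (lookup-map; lookup-zipWith; map-∘; map-cong; tabulate∘lookup; tabulate-cong)
open import Data.Product using (Σ; ∃; _×_; _,_)
open import Function using (_∘_)
open import Function.Bundles using (Equivalence)
open import Relation.Binary.Definitions using (DecidableEquality)
open import Relation.Binary.PropositionalEquality
  using (_≡_; _≢_; refl; sym; trans; cong; module ≡-Reasoning)
open import Relation.Nullary using (¬_; yes; no)

-- If V ∈ B(X,-Y) ∩ W, pick e with V_e ≠ X_e. Eliminating e between
-- [X,+] and [V,+] (O4) gives a covector of the form [Z,+] (the new coordinate is
-- not separated), and Z lies in I_e(X,-Y) because V agrees with X off S(X,-Y).

_≟ˢ_ : DecidableEquality Sign
⊕ ≟ˢ ⊕ = yes refl
⊕ ≟ˢ ⊖ = no λ ()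
⊕ ≟ˢ ⊙ = no λ ()
⊖ ≟ˢ ⊕ = no λ ()
⊖ ≟ˢ ⊖ = yes refl
⊖ ≟ˢ ⊙ = no λ ()
⊙ ≟ˢ ⊕ = no λ ()
⊙ ≟ˢ ⊖ = no λ ()
⊙ ≟ˢ ⊙ = yes refl

lookup-≢ : ∀ {n} {A B : SignVec n} → A ≢ B → ∃ λ e → lookup A e ≢ lookup B e
lookup-≢ {n} {A} {B} A≢B =
  ¬∀⟶∃¬ n (λ e → lookup A e ≡ lookup B e) (λ e → lookup A e ≟ˢ lookup B e) pointwise⇒≢
  where
  pointwise⇒≢ : ¬ (∀ e → lookup A e ≡ lookup B e)
  pointwise⇒≢ A≗B = A≢B (begin
    A                   ≡⟨ tabulate∘lookup A ⟨
    tabulate (lookup A) ≡⟨ tabulate-cong A≗B ⟩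
    tabulate (lookup B) ≡⟨ tabulate∘lookup B ⟩
    B                   ∎)
    where open ≡-Reasoning

compS-idem : ∀ s → compS s s ≡ s
compS-idem ⊕ = refl
compS-idem ⊖ = refl
compS-idem ⊙ = refl

nonzeroS-≡⊙ : ∀ {s t} → nonzeroS s ≡ nonzeroS t → s ≡ ⊙ → t ≡ ⊙
nonzeroS-≡⊙ {t = ⊙} _ _ = refl
nonzeroS-≡⊙ {t = ⊕} eq refl with () ← eq
nonzeroS-≡⊙ {t = ⊖} eq refl with () ← eq

supp-≡⊙ : ∀ {n} {A B : SignVec n} → supp A ≡ supp B → ∀ f → lookup A f ≡ ⊙ → lookup B f ≡ ⊙
supp-≡⊙ {A = A} {B} eq f = nonzeroS-≡⊙ (begin
  nonzeroS (lookup A f) ≡⟨ lookup-map f nonzeroS A ⟨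
  lookup (supp A) f     ≡⟨ cong (λ v → lookup v f) eq ⟩
  lookup (supp B) f     ≡⟨ lookup-map f nonzeroS B ⟩
  nonzeroS (lookup B f) ∎)
  where open ≡-Reasoning

affine-elimination : ∀ {n} {W : SVSet n} → IsAffineOM W →
  ∀ {X V} → W X → W V → supp X ≡ supp V → ∀ e → InS X V e →
  Σ (SignVec n) λ Z → W Z × (lookup Z e ≡ ⊙) ×
    (∀ f → ¬ InS X V f → lookup Z f ≡ lookup (X ∘ₛ V) f)
affine-elimination (O , om , W⇔O) {X} {V} WX WV supp≡ e e∈S
  with z ∷ Z , O[z,Z] , Ze≡⊙ , Z≡outside ←
       IsOM.O4 om (⊕ ∷ X) (⊕ ∷ V) (Equivalence.to (W⇔O X) WX) (Equivalence.to (W⇔O V) WV)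
         (cong (_ ∷_) supp≡) (suc e) e∈S
  with refl ← Z≡outside zero (λ (_ , _ , ⊕≢⊕) → ⊕≢⊕ refl)
  = Z , Equivalence.from (W⇔O Z) O[z,Z] , Ze≡⊙ ,
    λ f → Z≡outside (suc f)

supp-neg : ∀ {n} (X : SignVec n) → supp (neg X) ≡ supp X
supp-neg X = trans (sym (map-∘ nonzeroS negS X)) (map-cong nonzeroS∘negS X)
  where
  nonzeroS∘negS : ∀ s → nonzeroS (negS s) ≡ nonzeroS s
  nonzeroS∘negS ⊕ = refl
  nonzeroS∘negS ⊖ = refl
  nonzeroS∘negS ⊙ = refl

module _ {n} {X Y V : SignVec n} (suppY≡suppX : supp Y ≡ supp X)
         (suppV≡suppX : supp V ≡ supp X) (V≡X-outside : AgreeOutsideS X Y V) where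

  ∉S-XY⇒∉S-XV : ∀ {f} → ¬ InS X Y f → ¬ InS X V f
  ∉S-XY⇒∉S-XV {f} f∉S (_ , _ , Xf≢Vf) = Xf≢Vf (sym (V≡X-outside f f∉S))

  differ⇒∈S : ∀ {e} → lookup V e ≢ lookup X e → InS X Y e × InS X V e
  differ⇒∈S {e} Ve≢Xe = (Xe≢⊙ , Ye≢⊙ , Xe≢Ye) , (Xe≢⊙ , Ve≢⊙ , Ve≢Xe ∘ sym)
    where
    Xe≢⊙ : lookup X e ≢ ⊙
    Xe≢⊙ Xe≡⊙ = Ve≢Xe (trans (supp-≡⊙ (sym suppV≡suppX) e Xe≡⊙) (sym Xe≡⊙))
    Ve≢⊙ : lookup V e ≢ ⊙
    Ve≢⊙ = Xe≢⊙ ∘ supp-≡⊙ suppV≡suppX e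
    Ye≢⊙ : lookup Y e ≢ ⊙
    Ye≢⊙ = Xe≢⊙ ∘ supp-≡⊙ suppY≡suppX e
    Xe≢Ye : lookup X e ≢ lookup Y e
    Xe≢Ye Xe≡Ye = Ve≢Xe (V≡X-outside e λ (_ , _ , Xe≢Ye) → Xe≢Ye Xe≡Ye)

  eliminant-∈Ie : ∀ {e} Z → lookup Z e ≡ ⊙ →
    (∀ f → ¬ InS X V f → lookup Z f ≡ lookup (X ∘ₛ V) f) → InIe X Y e Z
  eliminant-∈Ie {e} Z Ze≡⊙ Z≡X∘V-outside = supp-Z , Z≡X-outside
    where
    Z≡compS : ∀ f → ¬ InS X V f → lookup Z f ≡ compS (lookup X f) (lookup V f)
    Z≡compS f f∉S = trans (Z≡X∘V-outside f f∉S) (lookup-zipWith compS f X V)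
    supp-Z : ∀ f → lookup Z f ≢ ⊙ → (lookup X f ≢ ⊙) × (f ≢ e)
    supp-Z f Zf≢⊙ = Xf≢⊙ , λ { refl → Zf≢⊙ Ze≡⊙ }
      where
      Xf≢⊙ : lookup X f ≢ ⊙
      Xf≢⊙ Xf≡⊙ = Zf≢⊙ (begin
        lookup Z f                        ≡⟨ Z≡compS f (λ (Xf≢⊙ , _) → Xf≢⊙ Xf≡⊙) ⟩
        compS (lookup X f) (lookup V f)   ≡⟨ cong (λ s → compS s (lookup V f)) Xf≡⊙ ⟩
        lookup V f                        ≡⟨ supp-≡⊙ (sym suppV≡suppX) f Xf≡⊙ ⟩
        ⊙                                 ∎)
        where open ≡-Reasoning
    Z≡X-outside : AgreeOutsideS X Y Z
    Z≡X-outside f f∉S = begin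
      lookup Z f                        ≡⟨ Z≡compS f (∉S-XY⇒∉S-XV f∉S) ⟩
      compS (lookup X f) (lookup V f)   ≡⟨ cong (compS (lookup X f)) (V≡X-outside f f∉S) ⟩
      compS (lookup X f) (lookup X f)   ≡⟨ compS-idem (lookup X f) ⟩
      lookup X f                        ∎
      where open ≡-Reasoning

eliminant-∈I : ∀ {n} {W : SVSet n} → IsAffineOM W → ∀ {X Y V} → W X → W V →
  supp Y ≡ supp X → supp V ≡ supp X → V ≢ X → AgreeOutsideS X Y V →
  Σ (SignVec n) λ Z → W Z × InI X Y Z
eliminant-∈I affine WX WV suppY≡suppX suppV≡suppX V≢X V≡X-outside
  with e , Ve≢Xe ← lookup-≢ V≢X
  with e∈S-XY , e∈S-XV ← differ⇒∈S suppY≡suppX suppV≡suppX V≡X-outside Ve≢Xe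
  with Z , WZ , Ze≡⊙ , Z≡X∘V-outside ← affine-elimination affine WX WV (sym suppV≡suppX) e e∈S-XV
  = Z , WZ , e , e∈S-XY , eliminant-∈Ie suppY≡suppX suppV≡suppX V≡X-outside Z Ze≡⊙ Z≡X∘V-outside

lemma2p3 : (n : ℕ) (W : SVSet n) → IsAffineOM W →
           (X Y : SignVec n) → W X → W Y → supp X ≡ supp Y → X ≢ neg Y →
           (∀ V → InI X (neg Y) V → ¬ W V) →
           ∀ V → InB X (neg Y) V → ¬ W V
lemma2p3 n W affine X Y WX _ suppX≡suppY _ I∩W≡∅ V (V≢X , _ , suppV≡suppX , V≡X-outside) WV
  with Z , WZ , Z∈I ← eliminant-∈I affine WX WV (trans (supp-neg Y) (sym suppX≡suppY))
                        suppV≡suppX V≢X V≡X-outside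
  = I∩W≡∅ Z Z∈I WZ
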